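{- Let $B$ be a set. (i) For $T$ a predicate on $(\mathbb{N}\times B)^*$ closed under restriction, $T$ has an $\mathbb{N}$-$B$-choice function if and only if $\|T\|$ has an infinite branch. (ii) For $T$ a predicate on $B^*$ that is a tree, the upward arborification of $\widehat{T}$ has an $\mathbb{N}$-$B$-choice function if and only if $T$ has an infinite branch. (iii) For $T$ a predicate on $(\mathbb{N}\times B)^*$ closed under extension, $T$ is $\mathbb{N}$-$B$-barred if and only if $\|T\|$ is barred. (iv) For $T$ a predicate on $B^*$ that is monotone, the upward monotonisation of $\widehat{T}$ is $\mathbb{N}$-$B$-barred if and only if $T$ is barred.
   Context: $B^*$: finite sequences over $B$, $\langle\rangle$ empty, $u\star b$ extension, $|u|$ length; $T\subseteq B^*$ is a tree if $u\star b\in T\Rightarrow u\in T$, monotone if $u\in T\Rightarrow u\star b\in T$. For $\alpha:\mathbb{N}\to B$, $u\prec_s\alpha$ means $u(i)=\alpha(i)$ for $i<|u|$; $T\subseteq B^*$ has an infinite branch if $\exists\alpha\,\forall u\,(u\prec_s\alpha\Rightarrow u\in T)$ and is barred if $\forall\alpha\,\exists u\,(u\prec_s\alpha\wedge u\in T)$. For sets $A,B$, $(A\times B)^*$ is the set of finite sequences of pairs; $v\subseteq v'$ means every pair occurring in $v$ occurs in $v'$. $T\subseteq(A\times B)^*$ is closed under restriction if $v'\subseteq v\in T\Rightarrow v'\in T$ and closed under extension if $T\ni v\subseteq v'\Rightarrow v'\in T$; its upward arborification is $\{v\mid\exists v'\,(v\subseteq v'\wedge v'\in T)\}$ and its upward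 monotonisation is $\{v\mid\exists v'\,(v'\subseteq v\wedge v'\in T)\}$. For $\alpha:A\to B$, $v\prec\alpha$ means $\alpha(a)=b$ for every pair $(a,b)$ occurring in $v$. $T$ has an $A$-$B$-choice function if $\exists\alpha:A\to B\,\forall v\,(v\prec\alpha\Rightarrow v\in T)$; $T$ is $A$-$B$-barred if $\forall\alpha:A\to B\,\exists v\,(v\prec\alpha\wedge v\in T)$. For $u\in B^*$, $\mathrm{ord}(\langle\rangle)=\langle\rangle$ and $\mathrm{ord}(u\star b)=\mathrm{ord}(u)\star(|u|,b)$. For $T\subseteq(\mathbb{N}\times B)^*$, $\|T\|=\{u\in B^*\mid\mathrm{ord}(u)\in T\}$; for $T\subseteq B^*$, $\widehat{T}=\{v\mid\exists u\in T,\ v=\mathrm{ord}(u)\}$. -}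

module Defs where

open import Data.Nat using (ℕ; suc; _<_)
open import Data.List using (List; []; _∷_; _∷ʳ_; length; lookup)
open import Data.List.Membership.Propositional using (_∈_)
open import Data.Product using (_×_; _,_; Σ; ∃)
open import Data.Fin using (Fin; toℕ)
open import Relation.Binary.PropositionalEquality using (_≡_)

-- B* : finite sequences are lists; u ⋆ b is  u ∷ʳ b  (append at the end).

_≺s_ : {B : Set} → List B → (ℕ → B) → Set
u ≺s α = (i : Fin (length u)) → lookup u i ≡ α (toℕ i)

IsTree : {B : Set} → (List B → Set) → Set
IsTree {B} T = (u : List B) (b : B) → T (u ∷ʳ b) → T u

IsMonotone : {B : Set} → (List B → Set) → Set
IsMonotone {B} T = (u : List B) (b : B) → T u → T (u ∷ʳ b)

HasInfiniteBranch : {B : Set} → (List B → Set) → Set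
HasInfiniteBranch {B} T = Σ (ℕ → B) λ α → (u : List B) → u ≺s α → T u

IsBarred : {B : Set} → (List B → Set) → Set
IsBarred {B} T = (α : ℕ → B) → Σ (List B) λ u → (u ≺s α) × T u

_⊆_ : {A B : Set} → List (A × B) → List (A × B) → Set
v ⊆ v' = ∀ {p} → p ∈ v → p ∈ v'

ClosedUnderRestriction : {A B : Set} → (List (A × B) → Set) → Set
ClosedUnderRestriction {A} {B} T = (v' v : List (A × B)) → v' ⊆ v → T v → T v'

ClosedUnderExtension : {A B : Set} → (List (A × B) → Set) → Set
ClosedUnderExtension {A} {B} T = (v v' : List (A × B)) → v ⊆ v' → T v → T v'

UpwardArborification : {A B : Set} → (List (A × B) → Set) → List (A × B) → Set
UpwardArborification {A} {B} T v = Σ (List (A × B)) λ v' → (v ⊆ v') × T v'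

UpwardMonotonisation : {A B : Set} → (List (A × B) → Set) → List (A × B) → Set
UpwardMonotonisation {A} {B} T v = Σ (List (A × B)) λ v' → (v' ⊆ v) × T v'

_≺_ : {A B : Set} → List (A × B) → (A → B) → Set
v ≺ α = ∀ {a b} → (a , b) ∈ v → α a ≡ b

HasChoiceFunction : (A B : Set) → (List (A × B) → Set) → Set
HasChoiceFunction A B T = Σ (A → B) λ α → (v : List (A × B)) → v ≺ α → T v

IsBarredAB : (A B : Set) → (List (A × B) → Set) → Set
IsBarredAB A B T = (α : A → B) → Σ (List (A × B)) λ v → (v ≺ α) × T v

-- ord(⟨⟩) = ⟨⟩ , ord(u ⋆ b) = ord(u) ⋆ (|u| , b).
-- Since lists are cons-built, we compute it as ordFrom 0, where
-- ordFrom n u pairs the i-th entry of u with n + i.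
ordFrom : {B : Set} → ℕ → List B → List (ℕ × B)
ordFrom n [] = []
ordFrom n (x ∷ xs) = (n , x) ∷ ordFrom (suc n) xs

ord : {B : Set} → List B → List (ℕ × B)
ord = ordFrom 0

‖_‖ : {B : Set} → (List (ℕ × B) → Set) → List B → Set
‖ T ‖ u = T (ord u)

hat : {B : Set} → (List B → Set) → List (ℕ × B) → Set
hat {B} T v = Σ (List B) λ u → T u × (v ≡ ord u)

module Submission where

open import Defs
open import Data.Nat using (ℕ; suc; _+_; _<_; _≤_; _⊔_)
open import Data.Nat.Properties using (+-identityʳ; +-suc; m≤m+n; m≤m⊔n; m≤n⊔m; <-≤-trans; <-irrefl)
open import Data.List using (List; []; _∷_; _∷ʳ_; _++_; length; lookup; applyUpTo)
open import Data.List.Properties using (++-assoc; ++-identityʳ; length-applyUpTo; lookup-applyUpTo)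
open import Data.List.Relation.Unary.Any using (here; there)
open import Data.List.Membership.Propositional using (_∈_)
open import Data.Product using (_×_; _,_; ∃-syntax; map₂)
open import Data.Fin using (Fin; toℕ; fromℕ<) renaming (zero to fzero; suc to fsuc)
open import Data.Fin.Properties using (toℕ-fromℕ<)
open import Data.Empty using (⊥-elim)
open import Function using (id)
open import Function.Bundles using (_⇔_; mk⇔)
open import Function.Properties.Equivalence using () renaming (trans to ⇔-trans)
open import Relation.Unary using (_≐_)
open import Relation.Binary.PropositionalEquality
  using (_≡_; refl; sym; trans; cong; subst; subst₂)

-- ord u is the graph of u, read as a finite partial function ℕ → B.  A finite
-- list of pairs v with v ≺ α is contained in the graph of an initial segment of
-- α, namely one longer than every index occurring in v; conversely u ≺s α says
-- exactly that ord u ≺ α.  Hence choice functions and bars for T correspond to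
-- branches and bars for ‖ T ‖ once T is closed under restriction resp.
-- extension, which gives (i) and (iii).  For (ii) and (iv), ord u ⊆ ord u'
-- holds exactly when u is a prefix of u', so for a tree (a monotone predicate)
-- T the closure of T̂ pulls back along ord to T itself, and (i), (iii) apply.

module _ {A B : Set} where

  UpwardArborification-closedUnderRestriction :
    (T : List (A × B) → Set) → ClosedUnderRestriction (UpwardArborification T)
  UpwardArborification-closedUnderRestriction T v' v v'⊆v (w , v⊆w , t) =
    w , (λ p → v⊆w (v'⊆v p)) , t

  UpwardMonotonisation-closedUnderExtension :
    (T : List (A × B) → Set) → ClosedUnderExtension (UpwardMonotonisation T)
  UpwardMonotonisation-closedUnderExtension T v v' v⊆v' (w , w⊆v , t) =
    w , (λ p → v⊆v' (w⊆v p)) , t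

module _ {B : Set} where

  IsTree⇒prefix-closed : (T : List B → Set) → IsTree T → ∀ u w → T (u ++ w) → T u
  IsTree⇒prefix-closed T tree u [] t = subst T (++-identityʳ u) t
  IsTree⇒prefix-closed T tree u (x ∷ w) t =
    tree u x (IsTree⇒prefix-closed T tree (u ∷ʳ x) w (subst T (sym (++-assoc u (x ∷ []) w)) t))

  IsMonotone⇒extension-closed : (T : List B → Set) → IsMonotone T → ∀ u w → T u → T (u ++ w)
  IsMonotone⇒extension-closed T mono u [] t = subst T (sym (++-identityʳ u)) t
  IsMonotone⇒extension-closed T mono u (x ∷ w) t =
    subst T (++-assoc u (x ∷ []) w) (IsMonotone⇒extension-closed T mono (u ∷ʳ x) w (mono u x t))

  HasInfiniteBranch-resp-≐ : {S T : List B → Set} → S ≐ T →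
    HasInfiniteBranch S ⇔ HasInfiniteBranch T
  HasInfiniteBranch-resp-≐ (S⊆T , T⊆S) = mk⇔
    (λ (α , branch) → α , λ u u≺α → S⊆T (branch u u≺α))
    (λ (α , branch) → α , λ u u≺α → T⊆S (branch u u≺α))

  IsBarred-resp-≐ : {S T : List B → Set} → S ≐ T → IsBarred S ⇔ IsBarred T
  IsBarred-resp-≐ (S⊆T , T⊆S) = mk⇔
    (λ bar α → map₂ (map₂ S⊆T) (bar α))
    (λ bar α → map₂ (map₂ T⊆S) (bar α))

  ∈-ordFrom⁺ : ∀ k (u : List B) (i : Fin (length u)) → (k + toℕ i , lookup u i) ∈ ordFrom k u
  ∈-ordFrom⁺ k (x ∷ u) fzero = subst (λ a → (a , x) ∈ ordFrom k (x ∷ u)) (sym (+-identityʳ k)) (here refl)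
  ∈-ordFrom⁺ k (x ∷ u) (fsuc i) =
    subst (λ a → (a , lookup u i) ∈ ordFrom k (x ∷ u)) (sym (+-suc k (toℕ i)))
      (there (∈-ordFrom⁺ (suc k) u i))

  ∈-ordFrom⁻ : ∀ k (u : List B) {a b} → (a , b) ∈ ordFrom k u →
    ∃[ i ] (a ≡ k + toℕ i × lookup u i ≡ b)
  ∈-ordFrom⁻ k (x ∷ u) (here refl) = fzero , sym (+-identityʳ k) , refl
  ∈-ordFrom⁻ k (x ∷ u) (there p) with ∈-ordFrom⁻ (suc k) u p
  ... | i , refl , lookup≡b = fsuc i , sym (+-suc k (toℕ i)) , lookup≡b

  ∈-ordFrom⇒≤ : ∀ {k} (u : List B) {a b} → (a , b) ∈ ordFrom k u → k ≤ a
  ∈-ordFrom⇒≤ {k} u p with ∈-ordFrom⁻ k u p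
  ... | i , refl , _ = m≤m+n k (toℕ i)

  ≺s⇒ord-≺ : ∀ {u : List B} {α} → u ≺s α → ord u ≺ α
  ≺s⇒ord-≺ {u} u≺α p with ∈-ordFrom⁻ 0 u p
  ... | i , refl , refl = sym (u≺α i)

  ∈-ord-applyUpTo : ∀ (α : ℕ → B) n {a} → a < n → (a , α a) ∈ ord (applyUpTo α n)
  ∈-ord-applyUpTo α n {a} a<n =
    subst₂ (λ a' b → (a' , b) ∈ ord (applyUpTo α n)) (toℕ-fromℕ< a<len)
      (trans (lookup-applyUpTo α n i) (cong α (toℕ-fromℕ< a<len)))
      (∈-ordFrom⁺ 0 (applyUpTo α n) i)
    where
    a<len : a < length (applyUpTo α n)
    a<len = subst (a <_) (sym (length-applyUpTo α n)) a<n
    i : Fin (length (applyUpTo α n))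
    i = fromℕ< a<len

  ordFrom-⊆⇒prefix : ∀ k (u u' : List B) → ordFrom k u ⊆ ordFrom k u' → ∃[ w ] u' ≡ u ++ w
  ordFrom-⊆⇒prefix k [] u' _ = u' , refl
  ordFrom-⊆⇒prefix k (x ∷ u) [] u⊆u' with () ← u⊆u' (here refl)
  ordFrom-⊆⇒prefix k (x ∷ u) (y ∷ u') u⊆u' with u⊆u' (here refl)
  ... | there p = ⊥-elim (<-irrefl refl (∈-ordFrom⇒≤ u' p))
  ... | here refl = map₂ (cong (x ∷_)) (ordFrom-⊆⇒prefix (suc k) u u' tail⊆tail)
    where
    tail⊆tail : ordFrom (suc k) u ⊆ ordFrom (suc k) u'
    tail⊆tail p with u⊆u' (there p)
    ... | here refl = ⊥-elim (<-irrefl refl (∈-ordFrom⇒≤ u p))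
    ... | there q = q

  ord-⊆⇒prefix : ∀ (u u' : List B) → ord u ⊆ ord u' → ∃[ w ] u' ≡ u ++ w
  ord-⊆⇒prefix = ordFrom-⊆⇒prefix 0

bound : {A : Set} → List (ℕ × A) → ℕ
bound [] = 0
bound ((a , _) ∷ v) = suc a ⊔ bound v

∈⇒<bound : {A : Set} (v : List (ℕ × A)) {a : ℕ} {b : A} → (a , b) ∈ v → a < bound v
∈⇒<bound ((a , _) ∷ v) (here refl) = m≤m⊔n (suc a) (bound v)
∈⇒<bound ((a , _) ∷ v) (there p) = <-≤-trans (∈⇒<bound v p) (m≤n⊔m (suc a) (bound v))

module _ {B : Set} where

  initialSegment : (ℕ → B) → List (ℕ × B) → List B
  initialSegment α v = applyUpTo α (bound v)

  initialSegment-≺s : ∀ α v → initialSegment α v ≺s α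
  initialSegment-≺s α v = lookup-applyUpTo α (bound v)

  ≺⇒⊆-ord-initialSegment : ∀ {v : List (ℕ × B)} {α} → v ≺ α → v ⊆ ord (initialSegment α v)
  ≺⇒⊆-ord-initialSegment {v} {α} v≺α {a , b} p =
    subst (λ b → (a , b) ∈ ord (initialSegment α v)) (v≺α p)
      (∈-ord-applyUpTo α (bound v) (∈⇒<bound v p))

  choice⇔infiniteBranch : (T : List (ℕ × B) → Set) → ClosedUnderRestriction T →
    HasChoiceFunction ℕ B T ⇔ HasInfiniteBranch ‖ T ‖
  choice⇔infiniteBranch T restrict = mk⇔
    (λ (α , choice) → α , λ u u≺α → choice (ord u) (≺s⇒ord-≺ u≺α))
    (λ (α , branch) → α , λ v v≺α →
      restrict v _ (≺⇒⊆-ord-initialSegment v≺α) (branch _ (initialSegment-≺s α v)))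

  barredAB⇔barred : (T : List (ℕ × B) → Set) → ClosedUnderExtension T →
    IsBarredAB ℕ B T ⇔ IsBarred ‖ T ‖
  barredAB⇔barred T extend = mk⇔ (λ bar α → toSequenceBar α (bar α)) (λ bar α → toPairBar α (bar α))
    where
    toSequenceBar : ∀ α → ∃[ v ] (v ≺ α × T v) → ∃[ u ] (u ≺s α × ‖ T ‖ u)
    toSequenceBar α (v , v≺α , t) =
      initialSegment α v , initialSegment-≺s α v , extend v _ (≺⇒⊆-ord-initialSegment v≺α) t
    toPairBar : ∀ α → ∃[ u ] (u ≺s α × ‖ T ‖ u) → ∃[ v ] (v ≺ α × T v)
    toPairBar α (u , u≺α , t) = ord u , ≺s⇒ord-≺ u≺α , t

  ‖UpwardArborification-hat‖≐ : (T : List B → Set) → IsTree T →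
    ‖ UpwardArborification (hat T) ‖ ≐ T
  ‖UpwardArborification-hat‖≐ T tree = sound , λ {u} t → ord u , id , u , t , refl
    where
    sound : ∀ {u} → ‖ UpwardArborification (hat T) ‖ u → T u
    sound {u} (_ , u⊆u' , u' , t , refl) with ord-⊆⇒prefix u u' u⊆u'
    ... | w , refl = IsTree⇒prefix-closed T tree u w t

  ‖UpwardMonotonisation-hat‖≐ : (T : List B → Set) → IsMonotone T →
    ‖ UpwardMonotonisation (hat T) ‖ ≐ T
  ‖UpwardMonotonisation-hat‖≐ T mono = sound , λ {u} t → ord u , id , u , t , refl
    where
    sound : ∀ {u} → ‖ UpwardMonotonisation (hat T) ‖ u → T u
    sound {u} (_ , u'⊆u , u' , t , refl) with ord-⊆⇒prefix u' u u'⊆u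
    ... | w , refl = IsMonotone⇒extension-closed T mono u' w t

proposition13 : (B : Set) →
    ((T : List (ℕ × B) → Set) → ClosedUnderRestriction T →
       HasChoiceFunction ℕ B T ⇔ HasInfiniteBranch ‖ T ‖)
    × ((T : List B → Set) → IsTree T →
       HasChoiceFunction ℕ B (UpwardArborification (hat T)) ⇔ HasInfiniteBranch T)
    × ((T : List (ℕ × B) → Set) → ClosedUnderExtension T →
       IsBarredAB ℕ B T ⇔ IsBarred ‖ T ‖)
    × ((T : List B → Set) → IsMonotone T →
       IsBarredAB ℕ B (UpwardMonotonisation (hat T)) ⇔ IsBarred T)
proposition13 B =
  choice⇔infiniteBranch ,
  (λ T tree → ⇔-trans
    (choice⇔infiniteBranch _ (UpwardArborification-closedUnderRestriction (hat T)))
    (HasInfiniteBranch-resp-≐ (‖UpwardArborification-hat‖≐ T tree))) ,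
  barredAB⇔barred ,
  (λ T mono → ⇔-trans
    (barredAB⇔barred _ (UpwardMonotonisation-closedUnderExtension (hat T)))
    (IsBarred-resp-≐ (‖UpwardMonotonisation-hat‖≐ T mono)))
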